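{- Let $n\geq 4$ be an even integer. (a) If $a_1,\dots,a_k$ are even integers greater than $2$ with $4+\sum_{i=1}^k a_i=3n$, then there is no graph derangement of the checkerboard graph $R_{3,n}$ with cycle type $(a_1,\dots,a_k,4)$. (b) Consequently, $R_{3,n}$ is not even universal.
   Context: For positive integers $m,n$, the checkerboard graph $R_{m,n}$ has vertex set $\{1,\dots,m\}\times\{1,\dots,n\}$, with $(x_1,x_2)$ adjacent to $(y_1,y_2)$ iff $|x_1-y_1|+|x_2-y_2|=1$. A graph derangement of a graph $G=(V,E)$ is an injective map $f:V\to V$ with $f(v)$ adjacent to $v$ for all $v$. For a finite graph, the cycles of $f$ are its orbits, and the cycle type of $f$ is the partition of $\#V$ given by the multiset of cycle sizes. A finite graph with $N$ vertices is even universal if every partition of $N$ into even parts is the cycle type of some graph derangement of it. -}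

module Defs where

open import Data.Nat using (ℕ; zero; suc; _+_; _*_; _≤_; _<_; ∣_-_∣)
open import Data.Nat.Divisibility using (_∣_)
open import Data.Fin using (Fin; toℕ)
open import Data.Product using (Σ; ∃; _×_; _,_; proj₁; proj₂)
open import Data.List using (List; map)
open import Data.Nat.ListAction using (sum)
open import Data.List.Relation.Unary.All using (All)
open import Data.List.Relation.Unary.Any using (Any)
open import Data.List.Relation.Unary.AllPairs using (AllPairs)
open import Data.List.Relation.Binary.Permutation.Propositional using (_↭_)
open import Relation.Binary.PropositionalEquality using (_≡_)
open import Relation.Nullary using (¬_)
open import Function.Definitions using (Injective)

-- Vertices of the checkerboard graph R_{m,n}; coordinates are shifted to
-- {0,…,m-1} × {0,…,n-1} (adjacency is translation invariant).
Vertex : ℕ → ℕ → Set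
Vertex m n = Fin m × Fin n

Adj : ∀ {m n} → Vertex m n → Vertex m n → Set
Adj (x₁ , x₂) (y₁ , y₂) = ∣ toℕ x₁ - toℕ y₁ ∣ + ∣ toℕ x₂ - toℕ y₂ ∣ ≡ 1

record Derangement (m n : ℕ) : Set where
  field
    f     : Vertex m n → Vertex m n
    inj   : Injective _≡_ _≡_ f
    adj   : ∀ v → Adj v (f v)

iter : ∀ {A : Set} → (A → A) → ℕ → A → A
iter g zero    a = a
iter g (suc k) a = g (iter g k a)

SameOrbit : ∀ {A : Set} → (A → A) → A → A → Set
SameOrbit g u v = ∃ λ k → iter g k u ≡ v

CycleSize : ∀ {A : Set} → (A → A) → A → ℕ → Set
CycleSize g v k = (1 ≤ k) × (iter g k v ≡ v) × (∀ j → 1 ≤ j → j < k → ¬ (iter g j v ≡ v))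

-- g has cycle type λ: there is a list of cycles, given by a representative and
-- its size, such that the representatives lie in pairwise distinct orbits,
-- every vertex lies in one of these orbits, and the multiset of sizes is λ.
HasCycleType : ∀ {A : Set} → (A → A) → List ℕ → Set
HasCycleType {A} g λs =
  Σ (List (A × ℕ)) λ cs →
      All (λ c → CycleSize g (proj₁ c) (proj₂ c)) cs
    × AllPairs (λ c d → ¬ SameOrbit g (proj₁ c) (proj₁ d)) cs
    × (∀ u → Any (λ c → SameOrbit g (proj₁ c) u) cs)
    × (map proj₂ cs ↭ λs)

EvenPartition : ℕ → List ℕ → Set
EvenPartition N λs = All (λ a → (1 ≤ a) × (2 ∣ a)) λs × (sum λs ≡ N)

EvenUniversal : ℕ → ℕ → Set
EvenUniversal m n = ∀ λs → EvenPartition (m * n) λs →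
  Σ (Derangement m n) λ d → HasCycleType (Derangement.f d) λs

-- A 4-cycle of a grid derangement is a unit square, so in R_{3,n} it fills two
-- adjacent columns except for one vertex in each: a wall with a single gap per
-- column.  If f maps the gap g of the right column into the left column, the
-- region "left of the wall, outside the square" is closed under f, because the
-- only way out leads back to g and would make a 2-cycle; by the same token,
-- if f g lies right of the wall, the region right of the wall is closed under f.
-- Either way the orbit of g leaves g for good, which is impossible when every
-- vertex lies on a cycle.  So no derangement whose cycles all have length > 2
-- has a 4-cycle; neither the parity of n nor the sum of the parts matters for
-- this, they only make (3n - 4, 4) an even partition of 3n.
module Submission where

open import Defs
open import Data.Nat using (ℕ; zero; suc; _+_; _*_; _∸_; _≤_; _<_; ∣_-_∣; z≤n; s≤s; s≤s⁻¹)
open import Data.Nat.Properties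
  using (suc-injective; ≤-refl; ≤-reflexive; ≤-trans; ≤-antisym; ≤-<-connex; n≤1+n; 1+n≰n;
         m≤n⇒m<n∨m≡n; m≤n*m; *-monoʳ-≤; ∸-monoˡ-≤; m∸n+n≡m; ∣m-n∣≡0⇒m≡n; +-comm)
open import Data.Nat.Divisibility using (_∣_; divides; ∣-trans; n∣m*n; ∣m+n∣m⇒∣n)
open import Data.Fin using (Fin; zero; suc; toℕ; fromℕ<)
open import Data.Fin.Properties using (toℕ-injective; toℕ<n; toℕ-fromℕ<)
open import Data.Product using (Σ; ∃; ∃₂; _×_; _,_; proj₁; proj₂)
open import Data.Sum using (_⊎_; inj₁; inj₂)
open import Data.Empty using (⊥; ⊥-elim)
open import Data.List using (List; []; _∷_; _++_; [_]; map)
open import Data.Nat.ListAction using (sum)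
open import Data.List.Relation.Unary.All using (All; []; _∷_)
import Data.List.Relation.Unary.All as All
open import Data.List.Relation.Unary.All.Properties using (++⁺)
open import Data.List.Relation.Unary.Any using (here; there)
open import Data.List.Membership.Propositional using (_∈_; _∉_; find)
open import Data.List.Membership.Propositional.Properties using (∈-map⁺; ∈-map⁻; ∈-++⁺ʳ)
open import Data.List.Relation.Binary.Permutation.Propositional using (_↭_; refl; prep; swap; ↭-sym; ↭-trans)
open import Data.List.Relation.Binary.Permutation.Propositional.Properties using (∈-resp-↭; ++-comm; ↭-reverse)
open import Function using (_∘_)
open import Function.Definitions using (Injective)
open import Relation.Binary.PropositionalEquality
  using (_≡_; _≢_; refl; sym; trans; cong; cong₂; subst; module ≡-Reasoning)
open import Relation.Nullary using (¬_)

Pos : Set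
Pos = ℕ × ℕ

InUnit : ℕ → ℕ → Set
InUnit r a = a ≡ r ⊎ a ≡ suc r

InUnit⇒≤ : ∀ {r a} → InUnit r a → a ≤ suc r
InUnit⇒≤ {r} (inj₁ refl) = n≤1+n r
InUnit⇒≤     (inj₂ refl) = ≤-refl

module _ {A : Set} (g : A → A) where

  iter-suc : ∀ k a → iter g (suc k) a ≡ iter g k (g a)
  iter-suc zero    a = refl
  iter-suc (suc k) a = cong g (iter-suc k a)

  iter-+ : ∀ j k a → iter g (j + k) a ≡ iter g j (iter g k a)
  iter-+ zero    k a = refl
  iter-+ (suc j) k a = cong g (iter-+ j k a)

  iter-comm : ∀ j k a → iter g j (iter g k a) ≡ iter g k (iter g j a)
  iter-comm j k a = begin
    iter g j (iter g k a) ≡⟨ sym (iter-+ j k a) ⟩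
    iter g (j + k) a      ≡⟨ cong (λ i → iter g i a) (+-comm j k) ⟩
    iter g (k + j) a      ≡⟨ iter-+ k j a ⟩
    iter g k (iter g j a) ∎
    where open ≡-Reasoning

  iter-injective : Injective _≡_ _≡_ g → ∀ k → Injective _≡_ _≡_ (iter g k)
  iter-injective g-inj zero    e = e
  iter-injective g-inj (suc k) e = iter-injective g-inj k (g-inj e)

  iter-preserves : (P : A → Set) → (∀ {a} → P a → P (g a)) → ∀ k {a} → P a → P (iter g k a)
  iter-preserves P inv zero    p = p
  iter-preserves P inv (suc k) p = inv (iter-preserves P inv k p)

  closed⇒periodic-mem : (P : A → Set) → (∀ {a} → P a → P (g a)) →
                        ∀ {u k} → iter g (suc k) u ≡ u → P (g u) → P u
  closed⇒periodic-mem P inv {u} {k} periodic p =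
    subst P (trans (sym (iter-suc k u)) periodic) (iter-preserves P inv k p)

module _ {A : Set} {g : A → A} where

  cycleSize-along : Injective _≡_ _≡_ g → ∀ {c s} → CycleSize g c s →
                    ∀ k → CycleSize g (iter g k c) s
  cycleSize-along g-inj {c} {s} (1≤s , closes , minimal) k =
    1≤s , closes′ , λ j 1≤j j<s e →
      minimal j 1≤j j<s (iter-injective g g-inj k (trans (iter-comm g k j c) e))
    where
    closes′ : iter g s (iter g k c) ≡ iter g k c
    closes′ = trans (iter-comm g s k c) (cong (iter g k) closes)

  cycleSize⇒periodic : ∀ {u s} → CycleSize g u s → ∃ λ k → iter g (suc k) u ≡ u
  cycleSize⇒periodic {s = suc k} (_ , closes , _) = k , closes

  cycleSize⇒¬2-cycle : ∀ {u s} → CycleSize g u s → 2 < s → g (g u) ≢ u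
  cycleSize⇒¬2-cycle (_ , _ , minimal) 2<s = minimal 2 (s≤s z≤n) 2<s

  cycleSize-of : Injective _≡_ _≡_ g → ∀ {λs} → HasCycleType g λs →
                 ∀ u → ∃ λ s → s ∈ λs × CycleSize g u s
  cycleSize-of g-inj (cs , sizes , _ , covers , sizes↭λs) u =
    let (c , s) , c∈cs , (k , reaches) = find (covers u)
    in  s , ∈-resp-↭ sizes↭λs (∈-map⁺ proj₂ c∈cs)
          , subst (λ v → CycleSize g v s) reaches (cycleSize-along g-inj (All.lookup sizes c∈cs) k)

  part⇒cycle : ∀ {λs s} → HasCycleType g λs → s ∈ λs → ∃ λ c → CycleSize g c s
  part⇒cycle (cs , sizes , _ , _ , sizes↭λs) s∈λs
    with ∈-map⁻ proj₂ (∈-resp-↭ (↭-sym sizes↭λs) s∈λs)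
  ... | (c , _) , c∈cs , refl = c , All.lookup sizes c∈cs

data Step : Pos → Pos → Set where
  right : ∀ {r x} → Step (r , x) (r , suc x)
  left  : ∀ {r x} → Step (r , suc x) (r , x)
  down  : ∀ {r x} → Step (r , x) (suc r , x)
  up    : ∀ {r x} → Step (suc r , x) (r , x)

step-sym : ∀ {p q} → Step p q → Step q p
step-sym right = left
step-sym left  = right
step-sym down  = up
step-sym up    = down

step-irrefl : ∀ {p} → ¬ Step p p
step-irrefl ()

step-col : ∀ {r x r′ x′} → Step (r , x) (r′ , x′) → x′ ≡ suc x ⊎ x′ ≡ x ⊎ x ≡ suc x′
step-col right = inj₁ refl
step-col left  = inj₂ (inj₂ refl)
step-col down  = inj₂ (inj₁ refl)
step-col up    = inj₂ (inj₁ refl)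

step-col≤ : ∀ {r x r′ x′} → Step (r , x) (r′ , x′) → x′ ≤ suc x
step-col≤ right = ≤-refl
step-col≤ left  = ≤-trans (n≤1+n _) (n≤1+n _)
step-col≤ down  = n≤1+n _
step-col≤ up    = n≤1+n _

step-row : ∀ {r x r′ x′} → Step (r , x) (r′ , x′) → x′ ≡ suc x → r ≡ r′
step-row right _ = refl

∣m-n∣≡1 : ∀ m n → ∣ m - n ∣ ≡ 1 → n ≡ suc m ⊎ m ≡ suc n
∣m-n∣≡1 zero    (suc zero) _ = inj₁ refl
∣m-n∣≡1 (suc zero) zero    _ = inj₂ refl
∣m-n∣≡1 (suc m) (suc n) e with ∣m-n∣≡1 m n e
... | inj₁ refl = inj₁ refl
... | inj₂ refl = inj₂ refl

m+n≡1 : ∀ m {n} → m + n ≡ 1 → (m ≡ 0 × n ≡ 1) ⊎ (m ≡ 1 × n ≡ 0)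
m+n≡1 zero       e = inj₁ (refl , e)
m+n≡1 (suc zero) e = inj₂ (refl , suc-injective e)

distance1⇒step : ∀ {r x r′ x′} → ∣ r - r′ ∣ + ∣ x - x′ ∣ ≡ 1 → Step (r , x) (r′ , x′)
distance1⇒step {r} {x} {r′} {x′} d with m+n≡1 ∣ r - r′ ∣ d
... | inj₁ (Δr≡0 , Δx≡1) with ∣m-n∣≡0⇒m≡n {r} {r′} Δr≡0 | ∣m-n∣≡1 x x′ Δx≡1
...   | refl | inj₁ refl = right
...   | refl | inj₂ refl = left
distance1⇒step {r} {x} {r′} {x′} d | inj₂ (Δr≡1 , Δx≡0)
  with ∣m-n∣≡1 r r′ Δr≡1 | ∣m-n∣≡0⇒m≡n {x} {x′} Δx≡0
...   | inj₁ refl | refl = down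
...   | inj₂ refl | refl = up

corners : ℕ → ℕ → List Pos
corners r x = (r , x) ∷ (r , suc x) ∷ (suc r , x) ∷ (suc r , suc x) ∷ []

Corner : ℕ → ℕ → Pos → Set
Corner r x (a , b) = InUnit r a × InUnit x b

∈-corners : ∀ {r x p} → p ∈ corners r x → Corner r x p
∈-corners (here refl)                         = inj₁ refl , inj₁ refl
∈-corners (there (here refl))                 = inj₁ refl , inj₂ refl
∈-corners (there (there (here refl)))         = inj₂ refl , inj₁ refl
∈-corners (there (there (there (here refl)))) = inj₂ refl , inj₂ refl

corner-∈ : ∀ {r x} p → Corner r x p → p ∈ corners r x
corner-∈ _ (inj₁ refl , inj₁ refl) = here refl
corner-∈ _ (inj₁ refl , inj₂ refl) = there (here refl)
corner-∈ _ (inj₂ refl , inj₁ refl) = there (there (here refl))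
corner-∈ _ (inj₂ refl , inj₂ refl) = there (there (there (here refl)))

UnitSquare : List Pos → Set
UnitSquare ps = ∃₂ λ r x → corners r x ↭ ps

clockwise : ∀ r x → UnitSquare ((r , x) ∷ (r , suc x) ∷ (suc r , suc x) ∷ (suc r , x) ∷ [])
clockwise r x = r , x , prep _ (prep _ (swap _ _ refl))

rotate : ∀ {p q s t} → UnitSquare (p ∷ q ∷ s ∷ t ∷ []) → UnitSquare (q ∷ s ∷ t ∷ p ∷ [])
rotate {p} {q} {s} {t} (r , x , π) = r , x , ↭-trans π (++-comm [ p ] (q ∷ s ∷ t ∷ []))

reverse-square : ∀ {p q s t} → UnitSquare (p ∷ q ∷ s ∷ t ∷ []) → UnitSquare (t ∷ s ∷ q ∷ p ∷ [])
reverse-square {p} {q} {s} {t} (r , x , π) =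
  r , x , ↭-trans π (↭-sym (↭-reverse (p ∷ q ∷ s ∷ t ∷ [])))

4-cycle⇒unitSquare : ∀ {p₀ p₁ p₂ p₃} → Step p₀ p₁ → Step p₁ p₂ → Step p₂ p₃ → Step p₃ p₀ →
                     p₀ ≢ p₂ → p₁ ≢ p₃ → UnitSquare (p₀ ∷ p₁ ∷ p₂ ∷ p₃ ∷ [])
4-cycle⇒unitSquare right down  left  up    _ _ = clockwise _ _
4-cycle⇒unitSquare down  left  up    right _ _ = rotate (clockwise _ _)
4-cycle⇒unitSquare left  up    right down  _ _ = rotate (rotate (clockwise _ _))
4-cycle⇒unitSquare up    right down  left  _ _ = rotate (rotate (rotate (clockwise _ _)))
4-cycle⇒unitSquare right up    left  down  _ _ = reverse-square (clockwise _ _)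
4-cycle⇒unitSquare up    left  down  right _ _ = rotate (reverse-square (clockwise _ _))
4-cycle⇒unitSquare left  down  right up    _ _ = rotate (rotate (reverse-square (clockwise _ _)))
4-cycle⇒unitSquare down  right up    left  _ _ = rotate (rotate (rotate (reverse-square (clockwise _ _))))
4-cycle⇒unitSquare right left  _     _     p₀≢p₂ _ = ⊥-elim (p₀≢p₂ refl)
4-cycle⇒unitSquare left  right _     _     p₀≢p₂ _ = ⊥-elim (p₀≢p₂ refl)
4-cycle⇒unitSquare down  up    _     _     p₀≢p₂ _ = ⊥-elim (p₀≢p₂ refl)
4-cycle⇒unitSquare up    down  _     _     p₀≢p₂ _ = ⊥-elim (p₀≢p₂ refl)
4-cycle⇒unitSquare _     right left  _     _ p₁≢p₃ = ⊥-elim (p₁≢p₃ refl)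
4-cycle⇒unitSquare _     left  right _     _ p₁≢p₃ = ⊥-elim (p₁≢p₃ refl)
4-cycle⇒unitSquare _     down  up    _     _ p₁≢p₃ = ⊥-elim (p₁≢p₃ refl)
4-cycle⇒unitSquare _     up    down  _     _ p₁≢p₃ = ⊥-elim (p₁≢p₃ refl)

module _ {m n : ℕ} where

  row col : Vertex m n → ℕ
  row v = toℕ (proj₁ v)
  col v = toℕ (proj₂ v)

  pos : Vertex m n → Pos
  pos v = row v , col v

  vertex-≡ : ∀ {u w} → row u ≡ row w → col u ≡ col w → u ≡ w
  vertex-≡ r≡ c≡ = cong₂ _,_ (toℕ-injective r≡) (toℕ-injective c≡)

  pos-injective : ∀ {u w} → pos u ≡ pos w → u ≡ w
  pos-injective e = vertex-≡ (cong proj₁ e) (cong proj₂ e)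

module _ {m n} (d : Derangement m n) where
  open Derangement d

  step : ∀ v → Step (pos v) (pos (f v))
  step v = distance1⇒step (adj v)

  col-f≤ : ∀ v → col (f v) ≤ suc (col v)
  col-f≤ v = step-col≤ (step v)

  col≤f : ∀ v → col v ≤ suc (col (f v))
  col≤f v = step-col≤ (step-sym (step v))

  f-no-fixed-point : ∀ v → f v ≢ v
  f-no-fixed-point v e = step-irrefl (subst (λ w → Step (pos v) (pos w)) e (step v))

  -- In R_{3,n} the blocked set is a 4-cycle, which fills columns x and x + 1
  -- except for one vertex in each.
  record Wall : Set₁ where
    field
      blocked     : Vertex m n → Set
      x           : ℕ
      blocked-pre : ∀ {v} → blocked (f v) → blocked v
      blocked-col : ∀ {v} → blocked v → col v ≤ suc x
      gap-unique  : ∀ {u w} → col u ≡ col w → InUnit x (col u) → ¬ blocked u → ¬ blocked w → u ≡ w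
      gap         : Vertex m n
      gap-col     : col gap ≡ suc x
      gap-free    : ¬ blocked gap

  module _ (periodic : ∀ u → ∃ λ k → iter f (suc k) u ≡ u) (¬2-cycle : ∀ u → f (f u) ≢ u)
           (W : Wall) where
    open Wall W

    private
      gap-returns : (P : Vertex m n → Set) → (∀ {v} → P v → P (f v)) → P (f gap) → P gap
      gap-returns P inv = closed⇒periodic-mem f P inv {k = proj₁ (periodic gap)} (proj₂ (periodic gap))

      f-gap-free : ¬ blocked (f gap)
      f-gap-free = gap-free ∘ blocked-pre

    gap-¬stays : col (f gap) ≢ col gap
    gap-¬stays e = f-no-fixed-point gap
      (gap-unique e (inj₂ (trans e gap-col)) f-gap-free gap-free)

    gap-¬left : col (f gap) ≢ x
    gap-¬left f-gap≡x = 1+n≰n (subst (_≤ x) gap-col gap≤x)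
      where
      Left : Vertex m n → Set
      Left v = col v ≤ x × ¬ blocked v

      left-closed : ∀ {v} → Left v → Left (f v)
      left-closed {v} (v≤x , v-free) with ≤-<-connex (col (f v)) x
      ... | inj₁ fv≤x = fv≤x , v-free ∘ blocked-pre
      ... | inj₂ x<fv = ⊥-elim (¬2-cycle gap (trans (cong f (sym v≡f-gap)) fv≡gap))
        where
        fv≡1+x : col (f v) ≡ suc x
        fv≡1+x = ≤-antisym (≤-trans (col-f≤ v) (s≤s v≤x)) x<fv
        v≡x : col v ≡ x
        v≡x = ≤-antisym v≤x (s≤s⁻¹ (≤-trans x<fv (col-f≤ v)))
        fv≡gap : f v ≡ gap
        fv≡gap = gap-unique (trans fv≡1+x (sym gap-col)) (inj₂ fv≡1+x)
                            (v-free ∘ blocked-pre) gap-free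
        v≡f-gap : v ≡ f gap
        v≡f-gap = gap-unique (trans v≡x (sym f-gap≡x)) (inj₁ v≡x) v-free f-gap-free

      gap≤x : col gap ≤ x
      gap≤x = proj₁ (gap-returns Left left-closed (≤-reflexive f-gap≡x , f-gap-free))

    gap-¬right : col (f gap) ≢ suc (suc x)
    gap-¬right f-gap≡2+x = 1+n≰n (subst (suc (suc x) ≤_) gap-col 2+x≤gap)
      where
      Right : Vertex m n → Set
      Right v = suc (suc x) ≤ col v

      right-closed : ∀ {v} → Right v → Right (f v)
      right-closed {v} 2+x≤v with m≤n⇒m<n∨m≡n (s≤s⁻¹ (≤-trans 2+x≤v (col≤f v)))
      ... | inj₁ 1+x<fv = 1+x<fv
      ... | inj₂ 1+x≡fv = ⊥-elim (¬2-cycle gap (trans (cong f (sym v≡f-gap)) fv≡gap))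
        where
        v≡2+x : col v ≡ suc (suc x)
        v≡2+x = ≤-antisym (subst (λ c → col v ≤ suc c) (sym 1+x≡fv) (col≤f v)) 2+x≤v
        v-free : ¬ blocked v
        v-free b = 1+n≰n (≤-trans 2+x≤v (blocked-col b))
        fv≡gap : f v ≡ gap
        fv≡gap = gap-unique (trans (sym 1+x≡fv) (sym gap-col)) (inj₂ (sym 1+x≡fv))
                            (v-free ∘ blocked-pre) gap-free
        -- v and f gap are both horizontal neighbours of gap, in the same column.
        v∼gap : row v ≡ row gap
        v∼gap = trans (sym (step-row (step-sym (step v)) (trans v≡2+x (cong suc 1+x≡fv))))
                      (cong row fv≡gap)
        gap∼f-gap : row gap ≡ row (f gap)
        gap∼f-gap = step-row (step gap) (trans f-gap≡2+x (cong suc (sym gap-col)))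
        v≡f-gap : v ≡ f gap
        v≡f-gap = vertex-≡ (trans v∼gap gap∼f-gap) (trans v≡2+x (sym f-gap≡2+x))

      2+x≤gap : suc (suc x) ≤ col gap
      2+x≤gap = gap-returns Right right-closed (≤-reflexive (sym f-gap≡2+x))

    no-wall : ⊥
    no-wall with step-col (step gap)
    ... | inj₁ e        = gap-¬right (trans e (cong suc gap-col))
    ... | inj₂ (inj₁ e) = gap-¬stays e
    ... | inj₂ (inj₂ e) = gap-¬left (suc-injective (trans (sym e) gap-col))

IsThirdRow : ℕ → Fin 3 → Set
IsThirdRow r ρ = ¬ InUnit r (toℕ ρ) × (∀ i → ¬ InUnit r (toℕ i) → i ≡ ρ)

third-row : ∀ {r} → suc r < 3 → ∃ (IsThirdRow r)
third-row {zero} _ = suc (suc zero) , (λ { (inj₁ ()) ; (inj₂ ()) }) , other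
  where
  other : ∀ i → ¬ InUnit 0 (toℕ i) → i ≡ suc (suc zero)
  other zero             i∉ = ⊥-elim (i∉ (inj₁ refl))
  other (suc zero)       i∉ = ⊥-elim (i∉ (inj₂ refl))
  other (suc (suc zero)) _  = refl
third-row {suc zero} _ = zero , (λ { (inj₁ ()) ; (inj₂ ()) }) , other
  where
  other : ∀ i → ¬ InUnit 1 (toℕ i) → i ≡ zero
  other zero             _  = refl
  other (suc zero)       i∉ = ⊥-elim (i∉ (inj₁ refl))
  other (suc (suc zero)) i∉ = ⊥-elim (i∉ (inj₂ refl))
third-row {suc (suc r)} (s≤s (s≤s (s≤s ())))

module _ {n} (d : Derangement 3 n) where
  open Derangement d

  orbit4 : Vertex 3 n → List (Vertex 3 n)
  orbit4 c = c ∷ f c ∷ f (f c) ∷ f (f (f c)) ∷ []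

  module _ {c} (cyc : CycleSize f c 4) where
    private
      closes : f (f (f (f c))) ≡ c
      closes = proj₁ (proj₂ cyc)

    orbit4-pre : ∀ {v} → f v ∈ orbit4 c → v ∈ orbit4 c
    orbit4-pre (here e)                         = there (there (there (here (inj (trans e (sym closes))))))
    orbit4-pre (there (here e))                 = here (inj e)
    orbit4-pre (there (there (here e)))         = there (here (inj e))
    orbit4-pre (there (there (there (here e)))) = there (there (here (inj e)))

    orbit4-square : UnitSquare (map pos (orbit4 c))
    orbit4-square = 4-cycle⇒unitSquare (step d c) (step d (f c)) (step d (f (f c))) last
                                         p₀≢p₂ (p₀≢p₂ ∘ cong pos ∘ inj ∘ pos-injective)
      where
      last : Step (pos (f (f (f c)))) (pos c)
      last = subst (λ w → Step (pos (f (f (f c)))) (pos w)) closes (step d (f (f (f c))))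
      p₀≢p₂ : pos c ≢ pos (f (f c))
      p₀≢p₂ e = proj₂ (proj₂ cyc) 2 (s≤s z≤n) (s≤s (s≤s (s≤s z≤n))) (sym (pos-injective e))

    square⇒wall : ∀ {r x} → corners r x ↭ map pos (orbit4 c) → Wall d
    square⇒wall {r} {x} π = record
      { blocked     = Blocked
      ; x           = x
      ; blocked-pre = ∈⇒blocked ∘ orbit4-pre ∘ blocked⇒∈
      ; blocked-col = InUnit⇒≤ ∘ proj₂
      ; gap-unique  = gap-unique
      ; gap         = proj₁ ρ , fromℕ< 1+x<n
      ; gap-col     = toℕ-fromℕ< 1+x<n
      ; gap-free    = proj₁ (proj₂ ρ) ∘ proj₁
      }
      where
      Blocked : Vertex 3 n → Set
      Blocked v = Corner r x (pos v)

      blocked⇒∈ : ∀ {v} → Blocked v → v ∈ orbit4 c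
      blocked⇒∈ {v} b with ∈-map⁻ pos (∈-resp-↭ π (corner-∈ (pos v) b))
      ... | w , w∈ , v≈w = subst (_∈ orbit4 c) (sym (pos-injective v≈w)) w∈

      ∈⇒blocked : ∀ {v} → v ∈ orbit4 c → Blocked v
      ∈⇒blocked v∈ = ∈-corners (∈-resp-↭ (↭-sym π) (∈-map⁺ pos v∈))

      far-corner : ∃ λ w → (suc r , suc x) ≡ pos w
      far-corner with ∈-map⁻ pos (∈-resp-↭ π (corner-∈ (suc r , suc x) (inj₂ refl , inj₂ refl)))
      ... | w , _ , e = w , e

      1+r<3 : suc r < 3
      1+r<3 = subst (_< 3) (sym (cong proj₁ (proj₂ far-corner))) (toℕ<n (proj₁ (proj₁ far-corner)))

      1+x<n : suc x < n
      1+x<n = subst (_< n) (sym (cong proj₂ (proj₂ far-corner))) (toℕ<n (proj₂ (proj₁ far-corner)))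

      ρ : ∃ (IsThirdRow r)
      ρ = third-row 1+r<3

      gap-unique : ∀ {u w} → col u ≡ col w → InUnit x (col u) → ¬ Blocked u → ¬ Blocked w → u ≡ w
      gap-unique {u} {w} cu≡cw xu u-free w-free = vertex-≡ (cong toℕ (trans ρu (sym ρw))) cu≡cw
        where
        ρu : proj₁ u ≡ proj₁ ρ
        ρu = proj₂ (proj₂ ρ) (proj₁ u) (λ ru → u-free (ru , xu))
        ρw : proj₁ w ≡ proj₁ ρ
        ρw = proj₂ (proj₂ ρ) (proj₁ w) (λ rw → w-free (rw , subst (InUnit x) cu≡cw xu))

    four-cycle⇒wall : Wall d
    four-cycle⇒wall = square⇒wall (proj₂ (proj₂ orbit4-square))

long-cycles⇒4∉cycleType : ∀ {n λs} (d : Derangement 3 n) → HasCycleType (Derangement.f d) λs →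
                          All (2 <_) λs → 4 ∉ λs
long-cycles⇒4∉cycleType d type long 4∈λs =
  no-wall d periodic ¬2-cycle (four-cycle⇒wall d (proj₂ (part⇒cycle type 4∈λs)))
  where
  open Derangement d
  periodic : ∀ u → ∃ λ k → iter f (suc k) u ≡ u
  periodic u = cycleSize⇒periodic (proj₂ (proj₂ (cycleSize-of inj type u)))
  ¬2-cycle : ∀ u → f (f u) ≢ u
  ¬2-cycle u = let _ , s∈λs , size = cycleSize-of inj type u in
               cycleSize⇒¬2-cycle size (All.lookup long s∈λs)

¬evenUniversal : ∀ {n} → 4 ≤ n → 2 ∣ n → ¬ EvenUniversal 3 n
¬evenUniversal {n} 4≤n 2∣n universal =
  let d , type = universal (v ∷ 4 ∷ []) (((≤-trans (s≤s z≤n) 2<v , 2∣v) ∷ (s≤s z≤n , 2∣4) ∷ []) , v+4≡3n)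
  in  long-cycles⇒4∉cycleType d type (2<v ∷ 2<4 ∷ []) (there (here refl))
  where
  v : ℕ
  v = 3 * n ∸ 4
  v+4≡3n : v + 4 ≡ 3 * n
  v+4≡3n = m∸n+n≡m (≤-trans 4≤n (m≤n*m n 3))
  2<v : 2 < v
  2<v = ≤-trans (s≤s (s≤s (s≤s z≤n))) (∸-monoˡ-≤ 4 (*-monoʳ-≤ 3 4≤n))
  2<4 : 2 < 4
  2<4 = s≤s (s≤s (s≤s z≤n))
  2∣4 : 2 ∣ 4
  2∣4 = divides 2 refl
  2∣v : 2 ∣ v
  2∣v = ∣m+n∣m⇒∣n (subst (2 ∣_) (sym (trans (+-comm 4 v) v+4≡3n)) (∣-trans 2∣n (n∣m*n 3)))
                   2∣4

proposition18 : ∀ (n : ℕ) → 4 ≤ n → 2 ∣ n →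
    (∀ (as : List ℕ) → All (λ a → (2 < a) × (2 ∣ a)) as → 4 + sum as ≡ 3 * n →
       ¬ (Σ (Derangement 3 n) λ d → HasCycleType (Derangement.f d) (as ++ [ 4 ])))
    × ¬ EvenUniversal 3 n
proposition18 n 4≤n 2∣n = no-4-cycle , ¬evenUniversal 4≤n 2∣n
  where
  no-4-cycle : ∀ as → All (λ a → (2 < a) × (2 ∣ a)) as → 4 + sum as ≡ 3 * n →
               ¬ (Σ (Derangement 3 n) λ d → HasCycleType (Derangement.f d) (as ++ [ 4 ]))
  no-4-cycle as parts _ (d , type) =
    long-cycles⇒4∉cycleType d type (++⁺ (All.map proj₁ parts) (s≤s (s≤s (s≤s z≤n)) ∷ []))
                                    (∈-++⁺ʳ as (here refl))
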